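{- Let $G$ be a graph of stably matchable pairs. Then every connected component $K$ of $G$ with more than two vertices is matching-covered (it has a perfect matching and every edge of $K$ belongs to some perfect matching of $K$) and has a 2-factor (a spanning 2-regular subgraph).
   Context: A stable matching instance consists of finite disjoint sets of students and residencies, where each student has a strict linear preference order on a subset of the residencies and each residency has a strict linear preference order on a subset of the students. A matching (set of student–residency pairs, each element in at most one pair) is stable if each of its pairs is mutually acceptable (each member appears in the other's list) and no mutually acceptable pair $(s,r)$ not in it has both $s$ unmatched or preferring $r$ to its partner and $r$ unmatched or preferring $s$ to its partner. The graph of stably matchable pairs of the instance is the bipartite graph whose vertices are all students and residencies and whose edges are the pairs occurring in at least one stable matching. A graph is a graph of stably matchable pairs if it is isomorphic to the graph of stably matchable pairs of some stable matching instance. -}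

module Defs where

open import Data.Nat using (ℕ)
open import Data.Fin using (Fin)
open import Data.Bool using (Bool; true)
open import Data.List using (List; _∷_; _++_)
open import Data.List.Membership.Propositional using (_∈_)
open import Data.List.Relation.Unary.Unique.Propositional using (Unique)
open import Data.Product using (Σ; _×_; _,_; ∃; ∃-syntax)
open import Data.Sum using (_⊎_; inj₁; inj₂)
open import Data.Empty using (⊥)
open import Relation.Nullary using (¬_)
open import Relation.Binary.PropositionalEquality using (_≡_; _≢_)
open import Relation.Binary.Construct.Closure.ReflexiveTransitive using (Star)

-- A strict linear order on a subset of A is given by a duplicate-free
-- list (most preferred first); the subset is the set of list elements.
-- a is preferred to b in l iff a occurs strictly before b.
Prefers : {A : Set} → List A → A → A → Set
Prefers {A} l a b =
  ∃[ xs ] ∃[ ys ] ∃[ zs ] (l ≡ xs ++ (a ∷ ys ++ (b ∷ zs)))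

record Instance (m n : ℕ) : Set where
  field
    sPref   : Fin m → List (Fin n)
    rPref   : Fin n → List (Fin m)
    sUnique : ∀ s → Unique (sPref s)
    rUnique : ∀ r → Unique (rPref r)

module _ {m n : ℕ} (I : Instance m n) where
  open Instance I

  MutuallyAcceptable : Fin m → Fin n → Set
  MutuallyAcceptable s r = (r ∈ sPref s) × (s ∈ rPref r)

  PairSet : Set
  PairSet = Fin m → Fin n → Bool

  In : PairSet → Fin m → Fin n → Set
  In M s r = M s r ≡ true

  IsMatching : PairSet → Set
  IsMatching M =
    (∀ s r r' → In M s r → In M s r' → r ≡ r') ×
    (∀ s s' r → In M s r → In M s' r → s ≡ s')

  StudentWants : PairSet → Fin m → Fin n → Set
  StudentWants M s r =
    (∀ r' → ¬ In M s r') ⊎ (∃[ r' ] (In M s r' × Prefers (sPref s) r r'))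

  ResidencyWants : PairSet → Fin m → Fin n → Set
  ResidencyWants M s r =
    (∀ s' → ¬ In M s' r) ⊎ (∃[ s' ] (In M s' r × Prefers (rPref r) s s'))

  IsStable : PairSet → Set
  IsStable M =
    IsMatching M ×
    (∀ s r → In M s r → MutuallyAcceptable s r) ×
    (∀ s r → MutuallyAcceptable s r → ¬ In M s r →
       ¬ (StudentWants M s r × ResidencyWants M s r))

  StablyMatchable : Fin m → Fin n → Set
  StablyMatchable s r = ∃[ M ] (Σ (IsStable M) λ _ → In M s r)

  SMPAdj : Fin m ⊎ Fin n → Fin m ⊎ Fin n → Set
  SMPAdj (inj₁ s) (inj₂ r) = StablyMatchable s r
  SMPAdj (inj₂ r) (inj₁ s) = StablyMatchable s r
  SMPAdj (inj₁ _) (inj₁ _) = ⊥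
  SMPAdj (inj₂ _) (inj₂ _) = ⊥

module _ {V : Set} (Adj : V → V → Set) where

  InComponent : V → V → Set
  InComponent v0 v = Star Adj v0 v

  MoreThanTwo : V → Set
  MoreThanTwo v0 = ∃[ a ] ∃[ b ] ∃[ c ]
    (InComponent v0 a × InComponent v0 b × InComponent v0 c ×
     a ≢ b × a ≢ c × b ≢ c)

  SubgraphOf : V → (V → V → Set) → Set
  SubgraphOf v0 F =
    (∀ u w → F u w → F w u) ×
    (∀ u w → F u w → InComponent v0 u × InComponent v0 w × Adj u w)

  PerfectMatching : V → (V → V → Set) → Set
  PerfectMatching v0 F =
    SubgraphOf v0 F ×
    (∀ v → InComponent v0 v → ∃[ u ] (F v u × (∀ w → F v w → w ≡ u)))

  MatchingCovered : V → Set₁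
  MatchingCovered v0 =
    (∃[ F ] PerfectMatching v0 F) ×
    (∀ u w → InComponent v0 u → Adj u w →
       ∃[ F ] (PerfectMatching v0 F × F u w))

  TwoFactor : V → (V → V → Set) → Set
  TwoFactor v0 F =
    SubgraphOf v0 F ×
    (∀ v → InComponent v0 v → ∃[ u ] ∃[ w ]
       (u ≢ w × F v u × F v w × (∀ x → F v x → (x ≡ u) ⊎ (x ≡ w))))

  HasTwoFactor : V → Set₁
  HasTwoFactor v0 = ∃[ F ] TwoFactor v0 F

-- Every vertex of a component with more than two vertices lies on an edge, so it is matched in some
-- stable matching and hence, by the rural hospitals theorem, in every one. Each stable matching therefore
-- restricts to a perfect matching of the component, and every edge lies in the one realising it.
-- The meet of all stable matchings is the student-optimal stable matching M₀, and dually the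
-- residency-optimal one Mz is student-pessimal. A student with the same partner r in M₀ and Mz has r in
-- every stable matching, and r has only that student, so the two would form a component by themselves.
-- Hence every vertex of the component has two distinct partners in M₀ ∪ Mz, which is thus a 2-factor.

module Submission where

open import Defs
open import Data.Nat using (ℕ; zero; suc)
open import Data.Nat.Properties using (n<1+n; <-irrefl)
open import Data.Fin using (Fin; zero; suc; toℕ; _≟_)
open import Data.Fin.Properties using (pigeonhole; any?; all?)
open import Data.Bool using (true; false)
import Data.Bool as Bool
open import Data.List using (List; []; _∷_; foldr; filter; cartesianProductWith)
open import Data.List.Properties using (∷-injective)
open import Data.List.Membership.Propositional using (_∈_)
open import Data.List.Membership.Propositional.Properties using (∈-++⁺ʳ; ∈-∃++)
open import Data.List.Relation.Unary.Any using (Any; here; there)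
open import Data.List.Relation.Unary.Any.Properties using (cartesianProductWith⁺; filter⁺; lookup-result)
open import Data.List.Relation.Unary.All as All using (All; []; _∷_; lookupAny)
open import Data.List.Relation.Unary.All.Properties using (all-filter)
open import Data.List.Relation.Unary.AllPairs using (_∷_)
open import Data.List.Relation.Unary.Unique.Propositional using (Unique)
open import Data.Vec.Functional as Vector using (Vector)
open import Data.Vec.Functional.Relation.Binary.Pointwise using (Pointwise)
open import Data.Product as Product using (Σ; _×_; _,_; ∃; ∃-syntax; proj₁; proj₂)
open import Data.Sum as Sum using (_⊎_; inj₁; inj₂; [_,_]; swap)
open import Data.Empty using (⊥; ⊥-elim)
open import Function using (_∘_; _$_; flip; id)
open import Relation.Nullary using (¬_; Dec; yes; no)
open import Relation.Nullary.Decidable using (_×-dec_; _⊎-dec_; _→-dec_; ¬?; map′; isYes; toWitness; fromWitness)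
open import Data.Bool.Properties using (T-≡)
open import Function.Bundles using (Equivalence)
open import Relation.Binary.Definitions using (DecidableEquality)
open import Relation.Binary.PropositionalEquality using (_≡_; _≢_; refl; sym; trans; cong; subst)
open import Relation.Binary.Construct.Closure.ReflexiveTransitive using (Star; ε; _◅_; _◅◅_; fold; reverse; return)

module Preference {A : Set} where

  private variable
    l : List A
    a b c x : A

  WeaklyPrefers : List A → A → A → Set
  WeaklyPrefers l a b = a ≡ b ⊎ Prefers l a b

  ¬Prefers-[] : ¬ Prefers [] a b
  ¬Prefers-[] ([] , _ , _ , ())
  ¬Prefers-[] (_ ∷ _ , _ , _ , ())

  Prefers-∷⁻ : Prefers (x ∷ l) a b → (x ≡ a × b ∈ l) ⊎ Prefers l a b
  Prefers-∷⁻ ([] , ys , _ , eq) with ∷-injective eq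
  ... | refl , refl = inj₁ (refl , ∈-++⁺ʳ ys (here refl))
  Prefers-∷⁻ (_ ∷ xs , ys , zs , eq) with ∷-injective eq
  ... | refl , eq′ = inj₂ (xs , ys , zs , eq′)

  Prefers-∷⁺ : (x ≡ a × b ∈ l) ⊎ Prefers l a b → Prefers (x ∷ l) a b
  Prefers-∷⁺ (inj₁ (refl , b∈l)) with ∈-∃++ b∈l
  ... | ys , zs , refl = [] , ys , zs , refl
  Prefers-∷⁺ {x = x} (inj₂ (xs , ys , zs , refl)) = x ∷ xs , ys , zs , refl

  Prefers⇒∈ : Prefers l a b → b ∈ l
  Prefers⇒∈ (xs , ys , _ , refl) = ∈-++⁺ʳ xs (there (∈-++⁺ʳ ys (here refl)))

  Prefers-asym : Unique l → Prefers l a b → ¬ Prefers l b a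
  Prefers-asym {l = []} _ p _ = ¬Prefers-[] p
  Prefers-asym {l = _ ∷ _} (x∉l ∷ u) p q with Prefers-∷⁻ p | Prefers-∷⁻ q
  ... | inj₁ (refl , b∈l) | inj₁ (refl , _) = All.lookup x∉l b∈l refl
  ... | inj₁ (refl , _)   | inj₂ q′         = All.lookup x∉l (Prefers⇒∈ q′) refl
  ... | inj₂ p′           | inj₁ (refl , _) = All.lookup x∉l (Prefers⇒∈ p′) refl
  ... | inj₂ p′           | inj₂ q′         = Prefers-asym u p′ q′

  Prefers-irrefl : Unique l → ¬ Prefers l a a
  Prefers-irrefl u p = Prefers-asym u p p

  Prefers-trans : Unique l → Prefers l a b → Prefers l b c → Prefers l a c
  Prefers-trans {l = []} _ p _ = ⊥-elim (¬Prefers-[] p)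
  Prefers-trans {l = _ ∷ _} (x∉l ∷ u) p q with Prefers-∷⁻ p | Prefers-∷⁻ q
  ... | inj₁ (refl , _) | inj₁ (_ , c∈l) = Prefers-∷⁺ (inj₁ (refl , c∈l))
  ... | inj₁ (refl , _) | inj₂ q′        = Prefers-∷⁺ (inj₁ (refl , Prefers⇒∈ q′))
  ... | inj₂ p′         | inj₁ (refl , _) = ⊥-elim (All.lookup x∉l (Prefers⇒∈ p′) refl)
  ... | inj₂ p′         | inj₂ q′        = Prefers-∷⁺ (inj₂ (Prefers-trans u p′ q′))

  Prefers-total : a ∈ l → b ∈ l → a ≢ b → Prefers l a b ⊎ Prefers l b a
  Prefers-total (here refl) (here refl) a≢b = ⊥-elim (a≢b refl)
  Prefers-total (here refl) (there b∈l) _ = inj₁ (Prefers-∷⁺ (inj₁ (refl , b∈l)))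
  Prefers-total (there a∈l) (here refl) _ = inj₂ (Prefers-∷⁺ (inj₁ (refl , a∈l)))
  Prefers-total (there a∈l) (there b∈l) a≢b =
    Sum.map (Prefers-∷⁺ ∘ inj₂) (Prefers-∷⁺ ∘ inj₂) (Prefers-total a∈l b∈l a≢b)

  Prefers-compare : DecidableEquality A → a ∈ l → b ∈ l → WeaklyPrefers l a b ⊎ Prefers l b a
  Prefers-compare {a = a} {b = b} _≟ᴬ_ a∈l b∈l with a ≟ᴬ b
  ... | yes a≡b = inj₁ (inj₁ a≡b)
  ... | no a≢b = Sum.map₁ inj₂ (Prefers-total a∈l b∈l a≢b)

  Prefers? : DecidableEquality A → ∀ l a b → Dec (Prefers l a b)
  Prefers? _≟ᴬ_ [] a b = no ¬Prefers-[]
  Prefers? _≟ᴬ_ (x ∷ l) a b =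
    map′ Prefers-∷⁺ Prefers-∷⁻ ((x ≟ᴬ a ×-dec b ∈? l) ⊎-dec Prefers? _≟ᴬ_ l a b)
    where open import Data.List.Membership.DecPropositional _≟ᴬ_ using (_∈?_)

  WeaklyPrefers? : DecidableEquality A → ∀ l a b → Dec (WeaklyPrefers l a b)
  WeaklyPrefers? _≟ᴬ_ l a b = a ≟ᴬ b ⊎-dec Prefers? _≟ᴬ_ l a b

  WeaklyPrefers-antisym : Unique l → WeaklyPrefers l a b → WeaklyPrefers l b a → a ≡ b
  WeaklyPrefers-antisym _ (inj₁ a≡b) _ = a≡b
  WeaklyPrefers-antisym _ (inj₂ _) (inj₁ b≡a) = sym b≡a
  WeaklyPrefers-antisym u (inj₂ p) (inj₂ q) = ⊥-elim (Prefers-asym u p q)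

  WeaklyPrefers⇒¬Prefers : Unique l → WeaklyPrefers l a b → ¬ Prefers l b a
  WeaklyPrefers⇒¬Prefers u (inj₁ refl) = Prefers-irrefl u
  WeaklyPrefers⇒¬Prefers u (inj₂ p) = Prefers-asym u p

  WeaklyPrefers-trans : Unique l → WeaklyPrefers l a b → WeaklyPrefers l b c → WeaklyPrefers l a c
  WeaklyPrefers-trans _ (inj₁ refl) q = q
  WeaklyPrefers-trans _ (inj₂ p) (inj₁ refl) = inj₂ p
  WeaklyPrefers-trans u (inj₂ p) (inj₂ q) = inj₂ (Prefers-trans u p q)

  Prefers-WeaklyPrefers-trans : Unique l → Prefers l a b → WeaklyPrefers l b c → Prefers l a c
  Prefers-WeaklyPrefers-trans _ p (inj₁ refl) = p
  Prefers-WeaklyPrefers-trans u p (inj₂ q) = Prefers-trans u p q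

open Preference

no-injective-chain : ∀ {k} {P : Fin k → Set} {Step : Fin k → Fin k → Set} →
                     (∀ {x} → P x → ∃[ y ] (Step x y × P y)) →
                     (∀ {x y z} → Step x z → Step y z → x ≡ y) →
                     ∀ {x₀} → P x₀ → (∀ {x} → P x → ¬ Step x x₀) → ⊥
no-injective-chain {k} {P} {Step} next injective {x₀} p₀ avoids =
  let (i , j , i<j , same) = pigeonhole (n<1+n k) (proj₁ ∘ chain ∘ toℕ)
  in <-irrefl (chain-injective (toℕ i) (toℕ j) same) i<j
  where
  chain : ℕ → Σ (Fin k) P
  chain zero = x₀ , p₀
  chain (suc i) = Product.map₂ proj₂ (next (proj₂ (chain i)))

  chain-step : ∀ i → Step (proj₁ (chain i)) (proj₁ (chain (suc i)))
  chain-step i = proj₁ (proj₂ (next (proj₂ (chain i))))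

  chain-injective : ∀ i j → proj₁ (chain i) ≡ proj₁ (chain j) → i ≡ j
  chain-injective zero zero _ = refl
  chain-injective zero (suc j) same =
    ⊥-elim (avoids (proj₂ (chain j)) (subst (Step _) (sym same) (chain-step j)))
  chain-injective (suc i) zero same =
    ⊥-elim (avoids (proj₂ (chain i)) (subst (Step _) same (chain-step i)))
  chain-injective (suc i) (suc j) same =
    cong suc (chain-injective i j (injective (chain-step i) (subst (Step _) (sym same) (chain-step j))))

functions : ∀ {A : Set} k → List A → List (Vector A k)
functions zero _ = Vector.[] ∷ []
functions (suc k) as = cartesianProductWith Vector._∷_ as (functions k as)

functions-complete : ∀ {A : Set} {R : A → A → Set} {as : List A} → (∀ a → Any (R a) as) →
                     ∀ k (f : Vector A k) → Any (Pointwise R f) (functions k as)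
functions-complete complete zero f = here (λ ())
functions-complete complete (suc k) f =
  cartesianProductWith⁺ Vector._∷_ (λ r rs → λ { zero → r ; (suc i) → rs i })
    (complete (f zero)) (functions-complete complete k (f ∘ suc))

transpose : ∀ {m n} → Instance m n → Instance n m
transpose I = record { sPref = rPref ; rPref = sPref ; sUnique = rUnique ; rUnique = sUnique }
  where open Instance I

transpose-stable : ∀ {m n} (I : Instance m n) {M : PairSet I} → IsStable I M → IsStable (transpose I) (flip M)
transpose-stable I ((uniqueˢ , uniqueʳ) , acceptable , no-blocking) =
  ((λ r s s′ → uniqueʳ s s′ r) , (λ r r′ s → uniqueˢ s r r′)) ,
  (λ r s → Product.swap ∘ acceptable s r) ,
  (λ r s (r∈ , s∈) ∉ (wants , rwants) → no-blocking s r (s∈ , r∈) ∉ (rwants , wants))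

module StableMatching {m n : ℕ} (I : Instance m n) where
  open Instance I

  private variable
    M M′ : PairSet I
    s s′ : Fin m
    r r′ : Fin n

  MatchedStudent : PairSet I → Fin m → Set
  MatchedStudent M s = ∃[ r ] In I M s r

  MatchedResidency : PairSet I → Fin n → Set
  MatchedResidency M r = ∃[ s ] In I M s r

  In? : (M : PairSet I) → ∀ s r → Dec (In I M s r)
  In? M s r = M s r Bool.≟ true

  matchedStudent? : (M : PairSet I) → ∀ s → Dec (MatchedStudent M s)
  matchedStudent? M s = any? (In? M s)

  matchedResidency? : (M : PairSet I) → ∀ r → Dec (MatchedResidency M r)
  matchedResidency? M r = any? (λ s → In? M s r)

  -- A record wrapper, so that M can be inferred from a proof of its stability.
  record Stable (M : PairSet I) : Set where
    constructor mkStable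
    field isStable : IsStable I M
  open Stable public

  stablyMatchable : Stable M → In I M s r → StablyMatchable I s r
  stablyMatchable stable i = _ , isStable stable , i

  unmatched⇒wants : ¬ MatchedStudent M s → StudentWants I M s r
  unmatched⇒wants unmatched = inj₁ (λ r i → unmatched (r , i))

  partnerˢ-unique : Stable M → In I M s r → In I M s r′ → r ≡ r′
  partnerˢ-unique stable = proj₁ (proj₁ (isStable stable)) _ _ _

  partnerʳ-unique : Stable M → In I M s r → In I M s′ r → s ≡ s′
  partnerʳ-unique stable = proj₂ (proj₁ (isStable stable)) _ _ _

  acceptable : Stable M → In I M s r → MutuallyAcceptable I s r
  acceptable stable = proj₁ (proj₂ (isStable stable)) _ _

  wants⇒prefers : Stable M → StudentWants I M s r → In I M s r′ → Prefers (sPref s) r r′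
  wants⇒prefers _ (inj₁ unmatched) i = ⊥-elim (unmatched _ i)
  wants⇒prefers {s = s} {r = r} stable (inj₂ (_ , i , p)) j =
    subst (Prefers (sPref s) r) (partnerˢ-unique stable i j) p

  wants⇒∉ : Stable M → StudentWants I M s r → ¬ In I M s r
  wants⇒∉ {s = s} stable wants i = Prefers-irrefl (sUnique s) (wants⇒prefers stable wants i)

  no-blocking-pair : Stable M → MutuallyAcceptable I s r → StudentWants I M s r → ¬ ResidencyWants I M s r
  no-blocking-pair stable ma wants rwants =
    proj₂ (proj₂ (isStable stable)) _ _ ma (wants⇒∉ stable wants) (wants , rwants)

  Stable-resp : (∀ s r → M s r ≡ M′ s r) → Stable M → Stable M′
  Stable-resp {M} {M′} same (mkStable ((uniqueˢ , uniqueʳ) , accepted , no-blocking)) = mkStable $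
    ((λ s r r′ i j → uniqueˢ s r r′ (back i) (back j)) , (λ s s′ r i j → uniqueʳ s s′ r (back i) (back j))) ,
    (λ s r → accepted s r ∘ back) ,
    (λ s r ma ∉ (wants , rwants) →
      no-blocking s r ma (∉ ∘ forth)
        ( Sum.map (λ unmatched r′ → unmatched r′ ∘ forth) (Product.map₂ (Product.map₁ back)) wants
        , Sum.map (λ unmatched s′ → unmatched s′ ∘ forth) (Product.map₂ (Product.map₁ back)) rwants ))
    where
    forth : In I M s r → In I M′ s r
    forth {s} {r} = trans (sym (same s r))
    back : In I M′ s r → In I M s r
    back {s} {r} = trans (same s r)

  stable? : ∀ M → Dec (Stable M)
  stable? M = map′ mkStable isStable $
    ( (all? λ s → all? λ r → all? λ r′ → In? M s r →-dec (In? M s r′ →-dec r ≟ r′))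
    ×-dec (all? λ s → all? λ s′ → all? λ r → In? M s r →-dec (In? M s′ r →-dec s ≟ s′)) )
    ×-dec (all? λ s → all? λ r → In? M s r →-dec acceptable? s r)
    ×-dec (all? λ s → all? λ r → acceptable? s r →-dec (¬? (In? M s r) →-dec ¬? (wants? s r ×-dec rwants? s r)))
    where
    open import Data.List.Membership.DecPropositional using (_∈?_)
    acceptable? : ∀ s r → Dec (MutuallyAcceptable I s r)
    acceptable? s r = _∈?_ _≟_ r (sPref s) ×-dec _∈?_ _≟_ s (rPref r)
    wants? : ∀ s r → Dec (StudentWants I M s r)
    wants? s r = all? (λ r′ → ¬? (In? M s r′)) ⊎-dec any? (λ r′ → In? M s r′ ×-dec Prefers? _≟_ (sPref s) r r′)
    rwants? : ∀ s r → Dec (ResidencyWants I M s r)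
    rwants? s r = all? (λ s′ → ¬? (In? M s′ r)) ⊎-dec any? (λ s′ → In? M s′ r ×-dec Prefers? _≟_ (rPref r) s s′)

  rival-preferred : Stable M → Stable M′ → In I M s r → StudentWants I M′ s r →
                    ∃[ s′ ] (In I M′ s′ r × Prefers (rPref r) s′ s)
  rival-preferred {M′ = M′} {r = r} stable stable′ i wants with matchedResidency? M′ r
  ... | no unmatched =
    ⊥-elim (no-blocking-pair stable′ (acceptable stable i) wants (inj₁ (λ s′ i′ → unmatched (s′ , i′))))
  ... | yes (s′ , i′) with Prefers-compare _≟_ (proj₂ (acceptable stable′ i′)) (proj₂ (acceptable stable i))
  ...   | inj₁ (inj₁ refl) = ⊥-elim (wants⇒∉ stable′ wants i′)
  ...   | inj₁ (inj₂ p) = s′ , i′ , p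
  ...   | inj₂ p = ⊥-elim (no-blocking-pair stable′ (acceptable stable i) wants (inj₂ (s′ , i′ , p)))

module RuralHospitals {m n : ℕ} (I : Instance m n) where
  open Instance I
  open StableMatching I
  private module ᵀ = StableMatching (transpose I)

  transposed : ∀ {M} → Stable M → ᵀ.Stable (flip M)
  transposed = ᵀ.mkStable ∘ transpose-stable I ∘ isStable

  untransposed : ∀ {M} → ᵀ.Stable M → Stable (flip M)
  untransposed = mkStable ∘ transpose-stable (transpose I) ∘ ᵀ.isStable

  private variable
    M M′ : PairSet I
    s s′ s″ : Fin m
    r : Fin n

  rival-prefers-own-partner : Stable M → Stable M′ → In I M s r → In I M′ s′ r → Prefers (rPref r) s′ s →
                              ∃[ r′ ] (In I M s′ r′ × Prefers (sPref s′) r′ r)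
  rival-prefers-own-partner stable stable′ i i′ p =
    ᵀ.rival-preferred (transposed stable′) (transposed stable) i′ (inj₂ (_ , i , p))

  BetterOffIn : PairSet I → PairSet I → Fin m → Set
  BetterOffIn M M′ s = ∃[ r ] (In I M s r × StudentWants I M′ s r)

  PartnerOfPartner : PairSet I → PairSet I → Fin m → Fin m → Set
  PartnerOfPartner M M′ s s′ = ∃[ r ] (In I M s r × In I M′ s′ r)

  betterOff-propagates : Stable M → Stable M′ → BetterOffIn M M′ s →
                         ∃[ s′ ] (PartnerOfPartner M M′ s s′ × BetterOffIn M M′ s′)
  betterOff-propagates stable stable′ (r , i , wants) with rival-preferred stable stable′ i wants
  ... | s′ , i′ , p with rival-prefers-own-partner stable stable′ i i′ p
  ... | r′ , j , q = s′ , (r , i , i′) , (r′ , j , inj₂ (r , i′ , q))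

  partnerOfPartner-injective : Stable M → Stable M′ →
                               PartnerOfPartner M M′ s s″ → PartnerOfPartner M M′ s′ s″ → s ≡ s′
  partnerOfPartner-injective stable stable′ (_ , i , i′) (_ , j , j′) with partnerˢ-unique stable′ i′ j′
  ... | refl = partnerʳ-unique stable i j

  -- Otherwise s ↦ (M′-partner of the M-partner of s), started at s, is an injective walk among the finitely
  -- many students that never returns to its start.
  rural-hospitals : Stable M → Stable M′ → In I M s r → MatchedStudent M′ s
  rural-hospitals {M′ = M′} {s} stable stable′ i with matchedStudent? M′ s
  ... | yes matched = matched
  ... | no unmatched =
    ⊥-elim (no-injective-chain (betterOff-propagates stable stable′) (partnerOfPartner-injective stable stable′)
              (_ , i , unmatched⇒wants {M = M′} unmatched) (λ _ (_ , _ , i′) → unmatched (_ , i′)))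

module StudentOptimal {m n : ℕ} (I : Instance m n) where
  open Instance I
  open StableMatching I
  open RuralHospitals I

  private variable
    M M′ M″ X : PairSet I
    s s′ : Fin m
    r r′ : Fin n

  InEither : PairSet I → PairSet I → Fin m → Fin n → Set
  InEither M M′ s r = In I M s r ⊎ In I M′ s r

  record BetterPartner (M M′ : PairSet I) (s : Fin m) (r : Fin n) : Set where
    constructor mkBetterPartner
    field
      inEither : InEither M M′ s r
      best : ∀ r′ → InEither M M′ s r′ → WeaklyPrefers (sPref s) r r′
  open BetterPartner

  betterPartner? : ∀ M M′ s r → Dec (BetterPartner M M′ s r)
  betterPartner? M M′ s r = map′ (Product.uncurry mkBetterPartner) (λ b → inEither b , best b) $
    (In? M s r ⊎-dec In? M′ s r) ×-dec
    all? (λ r′ → (In? M s r′ ⊎-dec In? M′ s r′) →-dec WeaklyPrefers? _≟_ (sPref s) r r′)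

  opaque
    meet : PairSet I → PairSet I → PairSet I
    meet M M′ s r = isYes (betterPartner? M M′ s r)

  opaque
    unfolding meet

    In-meet⁺ : BetterPartner M M′ s r → In I (meet M M′) s r
    In-meet⁺ {M} {M′} {s} {r} = Equivalence.to T-≡ ∘ fromWitness {a? = betterPartner? M M′ s r}

    In-meet⁻ : In I (meet M M′) s r → BetterPartner M M′ s r
    In-meet⁻ {M} {M′} {s} {r} = toWitness {a? = betterPartner? M M′ s r} ∘ Equivalence.from T-≡

  betterPartner-swap : BetterPartner M M′ s r → BetterPartner M′ M s r
  betterPartner-swap (mkBetterPartner either best) = mkBetterPartner (swap either) (λ r′ → best r′ ∘ swap)

  betterPartner-intro : Stable M → In I M s r → (∀ {r′} → In I M′ s r′ → WeaklyPrefers (sPref s) r r′) →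
                        BetterPartner M M′ s r
  betterPartner-intro stable i best =
    mkBetterPartner (inj₁ i) λ { _ (inj₁ j) → inj₁ (partnerˢ-unique stable i j) ; _ (inj₂ j) → best j }

  partner-dichotomy : Stable M → Stable M′ → In I M s r →
                      (∀ {r′} → In I M′ s r′ → WeaklyPrefers (sPref s) r r′) ⊎ BetterOffIn M′ M s
  partner-dichotomy {M′ = M′} {s} {r} stable stable′ i with matchedStudent? M′ s
  ... | no unmatched = inj₁ (λ j → ⊥-elim (unmatched (_ , j)))
  ... | yes (r′ , j) with Prefers-compare _≟_ (proj₁ (acceptable stable i)) (proj₁ (acceptable stable′ j))
  ...   | inj₁ weakly = inj₁ (λ k → subst (WeaklyPrefers (sPref s) r) (partnerˢ-unique stable′ j k) weakly)
  ...   | inj₂ p = inj₂ (r′ , j , inj₂ (r , i , p))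

  betterPartner-fromˡ : Stable M → Stable M′ → In I M s r → ∃[ r* ] BetterPartner M M′ s r*
  betterPartner-fromˡ stable stable′ i with partner-dichotomy stable stable′ i
  ... | inj₁ best = _ , betterPartner-intro stable i best
  ... | inj₂ (_ , j , wants) =
    _ , betterPartner-swap (betterPartner-intro stable′ j (inj₂ ∘ wants⇒prefers stable wants))

  betterPartner-exists : Stable M → Stable M′ → InEither M M′ s r → ∃[ r* ] BetterPartner M M′ s r*
  betterPartner-exists stable stable′ (inj₁ i) = betterPartner-fromˡ stable stable′ i
  betterPartner-exists stable stable′ (inj₂ j) = Product.map₂ betterPartner-swap (betterPartner-fromˡ stable′ stable j)

  betterPartner⇒wants : BetterPartner M M′ s r → ¬ In I M′ s r → StudentWants I M′ s r
  betterPartner⇒wants {M′ = M′} {s} (mkBetterPartner _ best) ∉ with matchedStudent? M′ s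
  ... | no unmatched = unmatched⇒wants {M = M′} unmatched
  ... | yes (r′ , j) with best r′ (inj₂ j)
  ...   | inj₁ refl = ⊥-elim (∉ j)
  ...   | inj₂ p = inj₂ (r′ , j , p)

  betterPartner-uniqueˢ : BetterPartner M M′ s r → BetterPartner M M′ s r′ → r ≡ r′
  betterPartner-uniqueˢ {s = s} (mkBetterPartner either best) (mkBetterPartner either′ best′) =
    WeaklyPrefers-antisym (sUnique s) (best _ either′) (best′ _ either)

  -- If s took r from M and s′ took r from M′, stability of M′ and of M make r prefer each of them to the other.
  betterPartner-crossed : Stable M → Stable M′ → BetterPartner M M′ s r → BetterPartner M′ M s′ r →
                          In I M s r → In I M′ s′ r → s ≡ s′
  betterPartner-crossed {M} {M′} {s} {r} {s′} stable stable′ better better′ i i′ with In? M′ s r | In? M s′ r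
  ... | yes j | _ = partnerʳ-unique stable′ j i′
  ... | no _ | yes j = partnerʳ-unique stable i j
  ... | no ∉ | no ∉′
    with rival-preferred stable stable′ i (betterPartner⇒wants better ∉)
       | rival-preferred stable′ stable i′ (betterPartner⇒wants better′ ∉′)
  ... | _ , k , p | _ , k′ , p′ with partnerʳ-unique stable′ k i′ | partnerʳ-unique stable k′ i
  ... | refl | refl = ⊥-elim (Prefers-asym (rUnique r) p p′)

  betterPartner-uniqueʳ : Stable M → Stable M′ → BetterPartner M M′ s r → BetterPartner M M′ s′ r → s ≡ s′
  betterPartner-uniqueʳ stable stable′ better better′ with inEither better | inEither better′
  ... | inj₁ i | inj₁ i′ = partnerʳ-unique stable i i′
  ... | inj₂ i | inj₂ i′ = partnerʳ-unique stable′ i i′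
  ... | inj₁ i | inj₂ i′ = betterPartner-crossed stable stable′ better (betterPartner-swap better′) i i′
  ... | inj₂ i | inj₁ i′ = sym (betterPartner-crossed stable stable′ better′ (betterPartner-swap better) i′ i)

  -- Otherwise the students better off in M′ than in M, followed from the M-partner of r on,
  -- would form an injective chain that never returns to its start.
  betterPartner-covers : Stable M → Stable M′ → In I M s r → ∃[ s′ ] BetterPartner M M′ s′ r
  betterPartner-covers {M = M} {M′ = M′} {s = s₁} {r = r} stable stable′ i₁
    with any? (λ s → betterPartner? M M′ s r)
  ... | yes found = found
  ... | no none with partner-dichotomy stable stable′ i₁
  ...   | inj₁ best = ⊥-elim (none (s₁ , betterPartner-intro stable i₁ best))
  ...   | inj₂ betterOff =
    ⊥-elim (no-injective-chain (betterOff-propagates stable′ stable) (partnerOfPartner-injective stable′ stable)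
              betterOff returns)
    where
    returns : ∀ {x} → BetterOffIn M′ M x → ¬ PartnerOfPartner M′ M x s₁
    returns {x} (_ , j , wants) (_ , j′ , i) with partnerˢ-unique stable′ j j′ | partnerˢ-unique stable i₁ i
    ... | refl | refl =
      none (x , betterPartner-swap (betterPartner-intro stable′ j (inj₂ ∘ wants⇒prefers stable wants)))

  meet-wants : Stable M → Stable M′ → (∀ {s r} → In I X s r → InEither M M′ s r) →
               StudentWants I (meet M M′) s r → StudentWants I X s r
  meet-wants stable stable′ into (inj₁ unmatched) =
    inj₁ λ _ j → let (r* , better) = betterPartner-exists stable stable′ (into j) in unmatched r* (In-meet⁺ better)
  meet-wants {X = X} {s = s} stable stable′ into (inj₂ (_ , i* , p)) with matchedStudent? X s
  ... | no unmatched = unmatched⇒wants {M = X} unmatched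
  ... | yes (r′ , j) = inj₂ (r′ , j , Prefers-WeaklyPrefers-trans (sUnique s) p (best (In-meet⁻ i*) r′ (into j)))

  meet-residencyWants : Stable M → Stable M′ → ResidencyWants I (meet M M′) s r →
                        ResidencyWants I M s r ⊎ ResidencyWants I M′ s r
  meet-residencyWants stable stable′ (inj₁ unmatched) =
    inj₁ (inj₁ λ _ i → let (s* , better) = betterPartner-covers stable stable′ i in unmatched s* (In-meet⁺ better))
  meet-residencyWants _ _ (inj₂ (s* , i* , p)) =
    Sum.map (λ i → inj₂ (s* , i , p)) (λ i → inj₂ (s* , i , p)) (inEither (In-meet⁻ i*))

  meet-stable : Stable M → Stable M′ → Stable (meet M M′)
  meet-stable stable stable′ = mkStable $
    ( (λ _ _ _ i j → betterPartner-uniqueˢ (In-meet⁻ i) (In-meet⁻ j))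
    , (λ _ _ _ i j → betterPartner-uniqueʳ stable stable′ (In-meet⁻ i) (In-meet⁻ j)) ) ,
    (λ _ _ i → [ acceptable stable , acceptable stable′ ] (inEither (In-meet⁻ i))) ,
    λ _ _ ma _ (wants , rwants) →
      [ no-blocking-pair stable ma (meet-wants stable stable′ inj₁ wants)
      , no-blocking-pair stable′ ma (meet-wants stable stable′ inj₂ wants) ]
      (meet-residencyWants stable stable′ rwants)

  StudentsWeaklyPrefer : PairSet I → PairSet I → Set
  StudentsWeaklyPrefer M M′ = ∀ {s r′} → In I M′ s r′ → ∃[ r ] (In I M s r × WeaklyPrefers (sPref s) r r′)

  StudentsWeaklyPrefer-trans : StudentsWeaklyPrefer M M′ → StudentsWeaklyPrefer M′ M″ → StudentsWeaklyPrefer M M″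
  StudentsWeaklyPrefer-trans below below′ {s} i″ =
    let (_ , i′ , weakly′) = below′ i″ ; (r , i , weakly) = below i′
    in r , i , WeaklyPrefers-trans (sUnique s) weakly weakly′

  meet-weaklyPreferredˡ : Stable M → Stable M′ → StudentsWeaklyPrefer (meet M M′) M
  meet-weaklyPreferredˡ stable stable′ i =
    let (r* , better) = betterPartner-exists stable stable′ (inj₁ i) in r* , In-meet⁺ better , best better _ (inj₁ i)

  meet-weaklyPreferredʳ : Stable M → Stable M′ → StudentsWeaklyPrefer (meet M M′) M′
  meet-weaklyPreferredʳ stable stable′ i =
    let (r* , better) = betterPartner-exists stable stable′ (inj₂ i) in r* , In-meet⁺ better , best better _ (inj₂ i)

  foldr-meet : ∀ {Ls} → Stable M → All Stable Ls →
               Stable (foldr meet M Ls) × All (StudentsWeaklyPrefer (foldr meet M Ls)) Ls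
  foldr-meet stable [] = stable , []
  foldr-meet stable (stableL ∷ stableLs) =
    let (stableAcc , below) = foldr-meet stable stableLs
    in meet-stable stableL stableAcc ,
       meet-weaklyPreferredˡ stableL stableAcc ∷
       All.map (StudentsWeaklyPrefer-trans (meet-weaklyPreferredʳ stableL stableAcc)) below

  pairSets : List (PairSet I)
  pairSets = functions m (functions n (true ∷ false ∷ []))

  pairSets-complete : ∀ M → Any (λ L → ∀ s r → M s r ≡ L s r) pairSets
  pairSets-complete M = functions-complete (functions-complete bool-complete n) m M
    where
    bool-complete : ∀ b → Any (b ≡_) (true ∷ false ∷ [])
    bool-complete true = here refl
    bool-complete false = there (here refl)

  IsStudentOptimal : PairSet I → Set
  IsStudentOptimal M₀ = Stable M₀ ×
    (∀ {M} → Stable M → ∀ {s r r′} → In I M₀ s r → In I M s r′ → WeaklyPrefers (sPref s) r r′)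

  student-optimal-exists : Stable M → ∃ IsStudentOptimal
  student-optimal-exists {M₁} stable₁ = M₀ , stable₀ , optimal
    where
    M₀ : PairSet I
    M₀ = foldr meet M₁ (filter stable? pairSets)

    folded : Stable M₀ × All (StudentsWeaklyPrefer M₀) (filter stable? pairSets)
    folded = foldr-meet stable₁ (all-filter stable? pairSets)

    stable₀ : Stable M₀
    stable₀ = proj₁ folded

    optimal : Stable M → ∀ {s r r′} → In I M₀ s r → In I M s r′ → WeaklyPrefers (sPref s) r r′
    optimal {M} stable i j with filter⁺ stable? (pairSets-complete M)
    ... | inj₂ unstable = ⊥-elim (unstable (Stable-resp (lookup-result (pairSets-complete M)) stable))
    ... | inj₁ found with lookupAny (proj₂ folded) found
    ... | below , same with below (trans (sym (same _ _)) j)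
    ... | _ , i* , weakly with partnerˢ-unique stable₀ i i*
    ... | refl = weakly

module ResidencySide {m n : ℕ} (I : Instance m n) where
  open Instance I
  open StableMatching I
  open RuralHospitals I using (transposed; untransposed)
  private
    module ᵀ = StudentOptimal (transpose I)
    module ᵀRural = RuralHospitals (transpose I)

  private variable
    M M′ : PairSet I
    s : Fin m
    r : Fin n

  rural-hospitalsʳ : Stable M → Stable M′ → In I M s r → MatchedResidency M′ r
  rural-hospitalsʳ stable stable′ = ᵀRural.rural-hospitals (transposed stable) (transposed stable′)

  IsStudentPessimal : PairSet I → Set
  IsStudentPessimal Mz = Stable Mz ×
    (∀ {M} → Stable M → ∀ {s r r′} → In I Mz s r → In I M s r′ → WeaklyPrefers (sPref s) r′ r)

  student-pessimal-exists : Stable M → ∃ IsStudentPessimal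
  student-pessimal-exists stable₁ with ᵀ.student-optimal-exists (transposed stable₁)
  ... | Mᵀ , stableᵀ , optimalᵀ = flip Mᵀ , stableᶻ , pessimal
    where
    stableᶻ : Stable (flip Mᵀ)
    stableᶻ = untransposed stableᵀ

    pessimal : Stable M → ∀ {s r r′} → In I (flip Mᵀ) s r → In I M s r′ → WeaklyPrefers (sPref s) r′ r
    pessimal stable {s} {r} i j with Prefers-compare _≟_ (proj₁ (acceptable stable j)) (proj₁ (acceptable stableᶻ i))
    ... | inj₁ weakly = weakly
    ... | inj₂ p with rival-preferred stableᶻ stable i (inj₂ (_ , j , p))
    ... | _ , k , q = ⊥-elim (WeaklyPrefers⇒¬Prefers (rUnique r) (optimalᵀ (transposed stable) i k) q)

module _ {V : Set} {Adj : V → V → Set} where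

  MoreThanTwo⇒edge : ∀ {v₀} → MoreThanTwo Adj v₀ → ∃[ w ] Adj v₀ w
  MoreThanTwo⇒edge (_ , _ , _ , e ◅ _ , _) = _ , e
  MoreThanTwo⇒edge (_ , _ , _ , ε , e ◅ _ , _) = _ , e
  MoreThanTwo⇒edge (_ , _ , _ , ε , ε , _ , a≢b , _) = ⊥-elim (a≢b refl)

  ¬MoreThanTwo-⊆-pair : ∀ {v₀ x y} → (∀ {v} → InComponent Adj v₀ v → v ≡ x ⊎ v ≡ y) → ¬ MoreThanTwo Adj v₀
  ¬MoreThanTwo-⊆-pair within (_ , _ , _ , pa , pb , pc , a≢b , a≢c , b≢c) with within pa | within pb | within pc
  ... | inj₁ refl | inj₁ refl | _ = a≢b refl
  ... | inj₂ refl | inj₂ refl | _ = a≢b refl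
  ... | inj₁ refl | _ | inj₁ refl = a≢c refl
  ... | inj₂ refl | _ | inj₂ refl = a≢c refl
  ... | _ | inj₁ refl | inj₁ refl = b≢c refl
  ... | _ | inj₂ refl | inj₂ refl = b≢c refl

  Star-preserves : {C : V → Set} → (∀ {u w} → Adj u w → C u → C w) → ∀ {u w} → Star Adj u w → C u → C w
  Star-preserves {C} step = fold (λ u w → C u → C w) (λ e f → f ∘ step e) id

  module _ (symmetric : ∀ {u w} → Adj u w → Adj w u) where

    edge-at-end : ∀ {u v} → Star Adj u v → ∃[ w ] Adj u w → ∃[ w ] Adj v w
    edge-at-end ε edge = edge
    edge-at-end (e ◅ path) _ = edge-at-end path (_ , symmetric e)

module _ {m n : ℕ} {I : Instance m n} where
  open StableMatching I

  SMPAdj-sym : ∀ {u w} → SMPAdj I u w → SMPAdj I w u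
  SMPAdj-sym {inj₁ _} {inj₂ _} e = e
  SMPAdj-sym {inj₂ _} {inj₁ _} e = e

  SMPAdj⇒stable : ∀ {u w} → SMPAdj I u w → ∃[ M ] Stable M
  SMPAdj⇒stable {inj₁ _} {inj₂ _} (M , stable , _) = M , mkStable stable
  SMPAdj⇒stable {inj₂ _} {inj₁ _} (M , stable , _) = M , mkStable stable

module Component {m n : ℕ} (I : Instance m n) {v₀ : Fin m ⊎ Fin n} (more : MoreThanTwo (SMPAdj I) v₀) where
  open Instance I
  open StableMatching I
  open RuralHospitals I
  open StudentOptimal I
  open ResidencySide I

  private variable
    M : PairSet I
    s : Fin m
    r r′ : Fin n
    u w : Fin m ⊎ Fin n

  InComp : Fin m ⊎ Fin n → Set
  InComp = InComponent (SMPAdj I) v₀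

  extend : InComp u → SMPAdj I u w → InComp w
  extend path e = path ◅◅ return e

  edge-in-comp : InComp w → ∃[ u ] SMPAdj I w u
  edge-in-comp path = edge-at-end SMPAdj-sym path (MoreThanTwo⇒edge more)

  some-stable : ∃[ M ] Stable M
  some-stable = SMPAdj⇒stable (proj₂ (MoreThanTwo⇒edge more))

  comp-matchedˢ : InComp (inj₁ s) → Stable M → MatchedStudent M s
  comp-matchedˢ path stable with edge-in-comp path
  ... | inj₂ _ , (_ , stable′ , i) = rural-hospitals (mkStable stable′) stable i

  comp-matchedʳ : InComp (inj₂ r) → Stable M → MatchedResidency M r
  comp-matchedʳ path stable with edge-in-comp path
  ... | inj₁ _ , (_ , stable′ , i) = rural-hospitalsʳ (mkStable stable′) stable i

  Restricted : (Fin m → Fin n → Set) → Fin m ⊎ Fin n → Fin m ⊎ Fin n → Set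
  Restricted R (inj₁ s) (inj₂ r) = InComp (inj₁ s) × R s r
  Restricted R (inj₂ r) (inj₁ s) = InComp (inj₁ s) × R s r
  Restricted R (inj₁ _) (inj₁ _) = ⊥
  Restricted R (inj₂ _) (inj₂ _) = ⊥

  restricted-subgraph : ∀ {R} → (∀ {s r} → R s r → StablyMatchable I s r) → SubgraphOf (SMPAdj I) v₀ (Restricted R)
  restricted-subgraph {R} matchable = symmetric , inside
    where
    symmetric : ∀ u w → Restricted R u w → Restricted R w u
    symmetric (inj₁ _) (inj₂ _) e = e
    symmetric (inj₂ _) (inj₁ _) e = e
    inside : ∀ u w → Restricted R u w → InComp u × InComp w × SMPAdj I u w
    inside (inj₁ _) (inj₂ _) (path , e) = path , extend path (matchable e) , matchable e
    inside (inj₂ _) (inj₁ _) (path , e) = extend path (matchable e) , path , matchable e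

  stable⇒perfect : Stable M → PerfectMatching (SMPAdj I) v₀ (Restricted (In I M))
  stable⇒perfect {M} stable = restricted-subgraph (stablyMatchable stable) , unique-neighbour
    where
    unique-neighbour : ∀ v → InComp v → ∃[ u ] (Restricted (In I M) v u × ∀ w → Restricted (In I M) v w → w ≡ u)
    unique-neighbour (inj₁ s) path with comp-matchedˢ path stable
    ... | r , i = inj₂ r , (path , i) , λ { (inj₂ _) (_ , j) → cong inj₂ (partnerˢ-unique stable j i) }
    unique-neighbour (inj₂ r) path with comp-matchedʳ path stable
    ... | s , i =
      inj₁ s , (extend path (stablyMatchable stable i) , i) ,
      λ { (inj₁ _) (_ , j) → cong inj₁ (partnerʳ-unique stable j i) }

  matching-covered : MatchingCovered (SMPAdj I) v₀
  matching-covered = (_ , stable⇒perfect (proj₂ some-stable)) , edge-covered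
    where
    edge-covered : ∀ u w → InComp u → SMPAdj I u w → ∃[ F ] (PerfectMatching (SMPAdj I) v₀ F × F u w)
    edge-covered (inj₁ _) (inj₂ _) path (_ , stable , i) = _ , stable⇒perfect (mkStable stable) , path , i
    edge-covered (inj₂ _) (inj₁ _) path e@(_ , stable , i) = _ , stable⇒perfect (mkStable stable) , extend path e , i

  private
    optimal : ∃ IsStudentOptimal
    optimal = student-optimal-exists (proj₂ some-stable)

    pessimal : ∃ IsStudentPessimal
    pessimal = student-pessimal-exists (proj₂ some-stable)

    M₀ Mz : PairSet I
    M₀ = proj₁ optimal
    Mz = proj₁ pessimal

    stable₀ : Stable M₀
    stable₀ = proj₁ (proj₂ optimal)

    stableᶻ : Stable Mz
    stableᶻ = proj₁ (proj₂ pessimal)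

    M₀-optimal : Stable M → In I M₀ s r → In I M s r′ → WeaklyPrefers (sPref s) r r′
    M₀-optimal stable = proj₂ (proj₂ optimal) stable

    Mz-pessimal : Stable M → In I Mz s r → In I M s r′ → WeaklyPrefers (sPref s) r′ r
    Mz-pessimal stable = proj₂ (proj₂ pessimal) stable

  only-partnerˢ : In I M₀ s r → In I Mz s r → ∀ {r′} → StablyMatchable I s r′ → r′ ≡ r
  only-partnerˢ {s} i₀ iᶻ (_ , stable , j) =
    WeaklyPrefers-antisym (sUnique s) (Mz-pessimal (mkStable stable) iᶻ j) (M₀-optimal (mkStable stable) i₀ j)

  only-partnerʳ : In I M₀ s r → In I Mz s r → ∀ {s′} → StablyMatchable I s′ r → s′ ≡ s
  only-partnerʳ i₀ iᶻ (_ , stable , j) with rural-hospitals stable₀ (mkStable stable) i₀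
  ... | _ , k with only-partnerˢ i₀ iᶻ (_ , stable , k)
  ... | refl = partnerʳ-unique (mkStable stable) j k

  fixed-pair-closed : In I M₀ s r → In I Mz s r → SMPAdj I u w → u ≡ inj₁ s ⊎ u ≡ inj₂ r → w ≡ inj₁ s ⊎ w ≡ inj₂ r
  fixed-pair-closed {w = inj₂ _} i₀ iᶻ e (inj₁ refl) = inj₂ (cong inj₂ (only-partnerˢ i₀ iᶻ e))
  fixed-pair-closed {w = inj₁ _} i₀ iᶻ e (inj₂ refl) = inj₁ (cong inj₁ (only-partnerʳ i₀ iᶻ e))
  fixed-pair-closed {w = inj₁ _} _ _ e (inj₁ refl) = ⊥-elim e
  fixed-pair-closed {w = inj₂ _} _ _ e (inj₂ refl) = ⊥-elim e

  fixed-pair-outside : In I M₀ s r → In I Mz s r → ¬ InComp (inj₁ s)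
  fixed-pair-outside i₀ iᶻ path =
    ¬MoreThanTwo-⊆-pair
      (λ path′ → Star-preserves (fixed-pair-closed i₀ iᶻ) (reverse SMPAdj-sym path ◅◅ path′) (inj₁ refl)) more

  two-factor : HasTwoFactor (SMPAdj I) v₀
  two-factor = Restricted Extreme , restricted-subgraph [ stablyMatchable stable₀ , stablyMatchable stableᶻ ] , degree-two
    where
    Extreme : Fin m → Fin n → Set
    Extreme s r = In I M₀ s r ⊎ In I Mz s r

    degree-two : ∀ v → InComp v → ∃[ u ] ∃[ w ] (u ≢ w × Restricted Extreme v u × Restricted Extreme v w ×
                                                 ∀ x → Restricted Extreme v x → x ≡ u ⊎ x ≡ w)
    degree-two (inj₁ s) path with comp-matchedˢ path stable₀ | comp-matchedˢ path stableᶻ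
    ... | r₀ , i₀ | rᶻ , iᶻ =
      inj₂ r₀ , inj₂ rᶻ , (λ { refl → fixed-pair-outside i₀ iᶻ path }) , (path , inj₁ i₀) , (path , inj₂ iᶻ) ,
      λ { (inj₂ _) (_ , inj₁ j) → inj₁ (cong inj₂ (partnerˢ-unique stable₀ j i₀))
        ; (inj₂ _) (_ , inj₂ j) → inj₂ (cong inj₂ (partnerˢ-unique stableᶻ j iᶻ)) }
    degree-two (inj₂ r) path with comp-matchedʳ path stable₀ | comp-matchedʳ path stableᶻ
    ... | s₀ , i₀ | sᶻ , iᶻ =
      inj₁ s₀ , inj₁ sᶻ , (λ { refl → fixed-pair-outside i₀ iᶻ path₀ }) , (path₀ , inj₁ i₀) , (pathᶻ , inj₂ iᶻ) ,
      λ { (inj₁ _) (_ , inj₁ j) → inj₁ (cong inj₁ (partnerʳ-unique stable₀ j i₀))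
        ; (inj₁ _) (_ , inj₂ j) → inj₂ (cong inj₁ (partnerʳ-unique stableᶻ j iᶻ)) }
      where
      path₀ : InComp (inj₁ s₀)
      path₀ = extend path (stablyMatchable stable₀ i₀)
      pathᶻ : InComp (inj₁ sᶻ)
      pathᶻ = extend path (stablyMatchable stableᶻ iᶻ)

mainTheorem2 : (m n : ℕ) (I : Instance m n) (v0 : Fin m ⊎ Fin n) →
    MoreThanTwo (SMPAdj I) v0 →
    MatchingCovered (SMPAdj I) v0 × HasTwoFactor (SMPAdj I) v0
mainTheorem2 m n I v0 more = Component.matching-covered I more , Component.two-factor I more
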